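{- Let $m\ge 3$ and let $A,B$ be two distinct triangulations of the convex $m$-gon with vertices labelled $0,1,\dots,m-1$ counterclockwise. Then the decreasingly ordered sequence of tails of the diagonals of $A$ differs from the decreasingly ordered sequence of tails of the diagonals of $B$.
   Context: A triangulation of a convex polygon is a set of its diagonals, pairwise either sharing an endpoint or non-intersecting, that divides the polygon into triangles. The tail of a diagonal $(a,b)$ with $a<b$ is $a$ (its smaller endpoint). -}

module Defs where

open import Data.Nat using (ℕ; zero; suc; _<_)
open import Data.Nat.Properties using (≤-decTotalOrder)
open import Data.Product using (_×_; _,_; proj₁)
open import Data.Sum using (_⊎_)
open import Data.List using (List; map)
open import Data.List.Membership.Propositional using (_∈_; _∉_)
open import Data.List.Relation.Unary.All using (All)
open import Data.List.Relation.Unary.Any using (Any)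
open import Data.List.Relation.Unary.AllPairs using (AllPairs)
open import Data.List.Relation.Unary.Unique.Propositional using (Unique)
open import Relation.Binary.PropositionalEquality using (_≡_)
open import Relation.Nullary using (¬_)
open import Relation.Binary.Properties.DecTotalOrder ≤-decTotalOrder
  using (≥-decTotalOrder)
import Data.List.Sort as Sort

-- A diagonal is written as an ordered pair (a , b) with a < b.
Diag : Set
Diag = ℕ × ℕ

-- (a , b) is a diagonal of the convex m-gon with vertices 0,…,m-1
-- (counterclockwise): a < b < m, the endpoints are not adjacent,
-- i.e. b ≠ a + 1 and (a , b) ≠ (0 , m - 1).
IsDiagonal : ℕ → Diag → Set
IsDiagonal m (a , b) = (a < b) × (suc a < b) × (b < m) × ¬ ((a ≡ 0) × (suc b ≡ m))

-- Two diagonals cross (intersect in their interiors) iff their endpoints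
-- strictly interleave around the polygon.
Cross : Diag → Diag → Set
Cross (a , b) (c , d) = ((a < c) × (c < b) × (b < d)) ⊎ ((c < a) × (a < d) × (d < b))

-- A triangulation of the convex m-gon: a (duplicate-free list representing a)
-- set of diagonals, pairwise non-crossing (sharing an endpoint or disjoint),
-- dividing the polygon into triangles, i.e. maximal: every other diagonal
-- crosses one of them.
record IsTriangulation (m : ℕ) (T : List Diag) : Set where
  field
    unique     : Unique T
    diagonals  : All (IsDiagonal m) T
    noncross   : AllPairs (λ x y → ¬ Cross x y) T
    maximal    : ∀ d → IsDiagonal m d → d ∉ T → Any (Cross d) T

tail : Diag → ℕ
tail = proj₁

sortDesc : List ℕ → List ℕ
sortDesc = Sort.sort ≥-decTotalOrder

tailSeq : List Diag → List ℕ
tailSeq T = sortDesc (map tail T)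

-- Two lists with the same sorted sequence of tails are permutations of one
-- another after mapping to tails, so A and B have, for every vertex a, the
-- same number of diagonals with tail a.  We then show, by downward induction
-- on a, that A and B contain the same diagonals with tail a.  Suppose they
-- agree on all tails above a and (a , b) ∈ A but (a , b) ∉ B.  By maximality
-- of B some (c , d) ∈ B crosses (a , b).  If a < c < b < d then (c , d) ∈ A
-- by the induction hypothesis, and it crosses (a , b) inside A; if
-- c < a < d < b then (c , d) also crosses every (a , b') ∈ B with b < b'.
-- Applying this exchange argument in both directions shows that every
-- diagonal of B with tail a already lies in A; together with (a , b) this
-- gives A strictly more diagonals of tail a than B, contradicting the counts.
-- Tails are bounded by m, so the induction starts above m with nothing to
-- prove, and the theorem follows since A and B then have the same members.
module Submission where

open import Defs
open import Data.Nat using (ℕ; _≤_; _<_; suc; zero; s≤s; z≤n; _+_; _≟_)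
open import Data.Nat.Properties
  using (<-irrefl; <-trans; <-cmp; ≤-trans; ≤-reflexive; +-suc; +-identityʳ;
         +-monoˡ-≤; m≤n+m; ≤-decTotalOrder)
open import Data.Product using (_,_; proj₁)
open import Data.Sum using (inj₁; inj₂)
open import Data.Empty using (⊥; ⊥-elim)
open import Data.List using (List; []; _∷_; map; filter; length; _++_)
open import Data.List.Properties using (length-++)
open import Data.List.Membership.Propositional using (_∈_; _∉_; find)
open import Data.List.Membership.Propositional.Properties
  using (∈-∃++; ∈-filter⁺; ∈-filter⁻; ∈-++⁻; ∈-++⁺ˡ; ∈-++⁺ʳ)
import Data.List.Relation.Unary.All as All
open import Data.List.Relation.Unary.All using (_∷_)
open import Data.List.Relation.Unary.Any using (here; there)
open import Data.List.Relation.Unary.AllPairs using (AllPairs; _∷_)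
open import Data.List.Relation.Unary.Unique.Propositional using (Unique)
open import Data.List.Relation.Unary.Unique.Propositional.Properties
  using (filter⁺)
open import Data.List.Relation.Binary.Permutation.Propositional
  using (_↭_; ↭-sym; ↭-trans)
open import Data.List.Relation.Binary.Permutation.Propositional.Properties
  using (↭-length; filter-↭)
open import Data.Product.Properties using (≡-dec)
open import Data.List.Membership.DecPropositional (≡-dec _≟_ _≟_) using (_∈?_)
open import Relation.Binary.Properties.DecTotalOrder ≤-decTotalOrder
  using (≥-decTotalOrder)
open import Data.List.Sort ≥-decTotalOrder using (sort-↭)
open import Function.Bundles using (_⇔_; mk⇔; Equivalence)
open import Relation.Binary.PropositionalEquality
  using (_≡_; refl; sym; trans; cong; subst)
open import Relation.Binary.Definitions using (tri<; tri≈; tri>)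
open import Relation.Nullary using (¬_; yes; no)
open import Relation.Unary using (Pred; Decidable)

open IsTriangulation

cross-sym : ∀ x y → Cross x y → Cross y x
cross-sym (a , b) (c , d) (inj₁ p) = inj₂ p
cross-sym (a , b) (c , d) (inj₂ p) = inj₁ p

cross-irrefl : ∀ x → ¬ Cross x x
cross-irrefl (a , b) (inj₁ (a<a , _)) = <-irrefl refl a<a
cross-irrefl (a , b) (inj₂ (a<a , _)) = <-irrefl refl a<a

noncrossing : ∀ {T x y} → AllPairs (λ x y → ¬ Cross x y) T →
              x ∈ T → y ∈ T → ¬ Cross x y
noncrossing (_ ∷ _)   (here refl) (here refl) = cross-irrefl _
noncrossing (px ∷ _)  (here refl) (there y∈)  = All.lookup px y∈
noncrossing (px ∷ _)  (there x∈)  (here refl) =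
  λ c → All.lookup px x∈ (cross-sym _ _ c)
noncrossing (_ ∷ pxs) (there x∈)  (there y∈)  = noncrossing pxs x∈ y∈

tail-bound : ∀ {m T c d} → IsTriangulation m T → (c , d) ∈ T → c < m
tail-bound T cd∈T with All.lookup (diagonals T) cd∈T
... | c<d , _ , d<m , _ = <-trans c<d d<m

unique-⊆-length : ∀ {ℓ} {X : Set ℓ} {ys xs : List X} → Unique ys →
                  (∀ {y} → y ∈ ys → y ∈ xs) → length ys ≤ length xs
unique-⊆-length {ys = []} _ _ = z≤n
unique-⊆-length {ys = y ∷ ys} (y∉ys ∷ u) ys⊆xs with ∈-∃++ (ys⊆xs (here refl))
... | as , bs , refl =
  subst (suc (length ys) ≤_) (sym length-split)
        (s≤s (unique-⊆-length u ys⊆as++bs))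
  where
  length-split : length (as ++ y ∷ bs) ≡ suc (length (as ++ bs))
  length-split = trans (length-++ as) (trans (+-suc (length as) (length bs))
                        (cong suc (sym (length-++ as))))
  ys⊆as++bs : ∀ {z} → z ∈ ys → z ∈ as ++ bs
  ys⊆as++bs z∈ys with ∈-++⁻ as (ys⊆xs (there z∈ys))
  ... | inj₁ z∈as         = ∈-++⁺ˡ z∈as
  ... | inj₂ (here refl)  = ⊥-elim (All.lookup y∉ys z∈ys refl)
  ... | inj₂ (there z∈bs) = ∈-++⁺ʳ as z∈bs

length-filter-map : ∀ {ℓ p} {X Y : Set ℓ} {P : Pred Y p} (P? : Decidable P)
                    (f : X → Y) (xs : List X) →
                    length (filter P? (map f xs)) ≡ length (filter (λ x → P? (f x)) xs)
length-filter-map P? f [] = refl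
length-filter-map P? f (x ∷ xs) with P? (f x)
... | yes _ = cong suc (length-filter-map P? f xs)
... | no _  = length-filter-map P? f xs

_atTail_ : List Diag → ℕ → List Diag
T atTail a = filter (λ d → tail d ≟ a) T

tailSeq-count : ∀ A B → tailSeq A ≡ tailSeq B →
                ∀ a → length (A atTail a) ≡ length (B atTail a)
tailSeq-count A B eq a =
  trans (sym (length-filter-map (_≟ a) tail A))
        (trans (↭-length (filter-↭ (_≟ a) tails-↭))
               (length-filter-map (_≟ a) tail B))
  where
  tails-↭ : map tail A ↭ map tail B
  tails-↭ = ↭-trans (↭-sym (sort-↭ (map tail A)))
                    (subst (_↭ map tail B) (sym eq) (sort-↭ (map tail B)))

AgreeAt : List Diag → List Diag → ℕ → Set
AgreeAt A B c = ∀ d → (c , d) ∈ A ⇔ (c , d) ∈ B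

AgreeAbove : List Diag → List Diag → ℕ → Set
AgreeAbove A B a = ∀ c → a < c → AgreeAt A B c

agreeAbove-sym : ∀ {A B a} → AgreeAbove A B a → AgreeAbove B A a
agreeAbove-sym agree c a<c d =
  mk⇔ (Equivalence.from (agree c a<c d)) (Equivalence.to (agree c a<c d))

-- If A and B agree above a, a diagonal (a , b) of A missing from B forbids
-- any longer diagonal (a , b') in B: whatever diagonal of B witnesses the
-- maximality of B against (a , b) crosses either (a , b) inside A or
-- (a , b') inside B.
exchange : ∀ {m A B a b b'} → IsTriangulation m A → IsTriangulation m B →
           AgreeAbove A B a → (a , b) ∈ A → (a , b) ∉ B → (a , b') ∈ B →
           b < b' → ⊥
exchange TA TB agree ab∈A ab∉B ab'∈B b<b'
  with find (maximal TB _ (All.lookup (diagonals TA) ab∈A) ab∉B)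
... | (c , d) , cd∈B , inj₁ (a<c , c<b , b<d) =
  noncrossing (noncross TA) ab∈A (Equivalence.from (agree c a<c d) cd∈B)
              (inj₁ (a<c , c<b , b<d))
... | (c , d) , cd∈B , inj₂ (c<a , a<d , d<b) =
  noncrossing (noncross TB) cd∈B ab'∈B (inj₁ (c<a , a<d , <-trans d<b b<b'))

tail-inclusion : ∀ {m A B a b} → IsTriangulation m A → IsTriangulation m B →
                 AgreeAbove A B a → (a , b) ∈ A → (a , b) ∉ B →
                 ∀ d → (a , d) ∈ B → (a , d) ∈ A
tail-inclusion {A = A} TA TB agree ab∈A ab∉B d ad∈B with (_ , d) ∈? A
... | yes ad∈A = ad∈A
... | no ad∉A with <-cmp _ d
...   | tri< b<d _ _ = ⊥-elim (exchange TA TB agree ab∈A ab∉B ad∈B b<d)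
...   | tri≈ _ refl _ = ⊥-elim (ad∉A ab∈A)
...   | tri> _ _ d<b =
  ⊥-elim (exchange TB TA (agreeAbove-sym agree) ad∈B ad∉A ab∈A d<b)

-- If A and B agree above a and have equally many diagonals of tail a, then
-- every diagonal of A with tail a is in B: otherwise (a , b) together with
-- the diagonals of B of tail a would be more diagonals of A of tail a.
descend : ∀ {m A B a} → IsTriangulation m A → IsTriangulation m B →
          AgreeAbove A B a → length (A atTail a) ≡ length (B atTail a) →
          ∀ b → (a , b) ∈ A → (a , b) ∈ B
descend {A = A} {B} {a} TA TB agree same-count b ab∈A with (a , b) ∈? B
... | yes ab∈B = ab∈B
... | no ab∉B =
  ⊥-elim (<-irrefl (sym same-count) (unique-⊆-length extended-unique extended⊆))
  where
  AtA? = λ (d : Diag) → tail d ≟ a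

  extended-unique : Unique ((a , b) ∷ B atTail a)
  extended-unique =
    All.tabulate (λ x∈ eq → ab∉B (subst (_∈ B) (sym eq)
                                        (proj₁ (∈-filter⁻ AtA? {xs = B} x∈))))
    ∷ filter⁺ AtA? (unique TB)

  extended⊆ : ∀ {x} → x ∈ (a , b) ∷ B atTail a → x ∈ A atTail a
  extended⊆ (here refl) = ∈-filter⁺ AtA? ab∈A refl
  extended⊆ {(_ , d)} (there x∈) with ∈-filter⁻ AtA? {xs = B} x∈
  ... | ad∈B , refl =
    ∈-filter⁺ AtA? (tail-inclusion TA TB agree ab∈A ab∉B d ad∈B) refl

-- Downward induction on the tail: starting from tails ≥ m, which no
-- diagonal has, equal counts let agreement descend one tail at a time.
agree-everywhere : ∀ {m A B} → IsTriangulation m A → IsTriangulation m B →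
                   (∀ a → length (A atTail a) ≡ length (B atTail a)) →
                   ∀ k c → m ≤ c + k → AgreeAt A B c
agree-everywhere {m} TA TB counts zero c m≤c+0 d = mk⇔ (absent TA) (absent TB)
  where
  m≤c : m ≤ c
  m≤c = ≤-trans m≤c+0 (≤-reflexive (+-identityʳ c))
  absent : ∀ {X T} → IsTriangulation m T → (c , d) ∈ T → X
  absent T cd∈T = ⊥-elim (<-irrefl refl (≤-trans (tail-bound T cd∈T) m≤c))
agree-everywhere TA TB counts (suc k) c m≤c+k+1 d =
  mk⇔ (descend TA TB above (counts c) d)
      (descend TB TA (agreeAbove-sym above) (sym (counts c)) d)
  where
  above : AgreeAbove _ _ c
  above c' c<c' = agree-everywhere TA TB counts k c'
    (≤-trans m≤c+k+1 (≤-trans (≤-reflexive (+-suc c k)) (+-monoˡ-≤ k c<c')))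

lemma1 : (m : ℕ) → 3 ≤ m → (A B : List Diag) → IsTriangulation m A → IsTriangulation m B
       → ¬ (∀ d → (d ∈ A) ⇔ (d ∈ B)) → ¬ (tailSeq A ≡ tailSeq B)
lemma1 m _ A B TA TB A≢B same-tails = A≢B same-members
  where
  same-members : ∀ d → (d ∈ A) ⇔ (d ∈ B)
  same-members (c , d) =
    agree-everywhere TA TB (tailSeq-count A B same-tails) m c (m≤n+m m c) d
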